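{- Let $K_{r,s}$ denote the complete bipartite graph with parts of sizes $r$ and $s$. Then: (i) for every $s\geq 1$, $\mathrm{lec}(K_{1,s})=s$; (ii) if $2\leq s\leq r\leq 2^s$, then $\mathrm{lec}(K_{r,s})=2$; (iii) for all other $r\geq s\geq 1$ (i.e. $s\geq 2$ and $r>2^s$), $\mathrm{lec}(K_{r,s})=3$.
   Context: Given an edge-colouring $\varphi:E(G)\to[1,k]$ of a connected simple graph $G$, a path is loose if it consists of exactly one edge, or of exactly two edges of different colours, or has at least three edges coloured with at least three distinct colours. $G$ is loose edge-connected under $\varphi$ if every two distinct vertices are joined by a loose path; the loose edge-connection number $\mathrm{lec}(G)$ is the least $k$ for which such a colouring exists. -}

module Defs where

open import Data.Nat using (ℕ; zero; suc; _<_; _≤_; _^_)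
open import Data.Fin using (Fin)
open import Data.Sum using (_⊎_; inj₁; inj₂)
open import Data.Product using (Σ; _×_; ∃; ∃-syntax)
open import Data.Unit using (⊤)
open import Data.Empty using (⊥)
open import Data.List using (List; []; _∷_; _∷ʳ_; length)
open import Data.List.Membership.Propositional using (_∈_)
open import Data.List.Relation.Unary.Unique.Propositional using (Unique)
open import Data.List.Relation.Unary.Linked using (Linked)
open import Relation.Binary.PropositionalEquality using (_≡_; _≢_)
open import Relation.Nullary using (¬_)

record Graph : Set₁ where
  field
    V     : Set
    Adj   : V → V → Set
    sym   : ∀ {u v} → Adj u v → Adj v u
    irrefl : ∀ {u} → ¬ Adj u u
open Graph public

-- An edge-colouring with colours Fin k (i.e. [1,k]): a colour c u v for each
-- ordered pair, required to be symmetric on edges (values on non-edges irrelevant).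
record EdgeColouring (G : Graph) (k : ℕ) : Set where
  field
    col    : V G → V G → Fin k
    colSym : ∀ {u v} → Adj G u v → col u v ≡ col v u
open EdgeColouring public

record Path (G : Graph) (u v : V G) : Set where
  field
    interior : List (V G)
    linked   : Linked (Adj G) (u ∷ interior ∷ʳ v)
    distinct : Unique (u ∷ interior ∷ʳ v)
open Path public

edgeColours : {G : Graph} {k : ℕ} → EdgeColouring G k → List (V G) → List (Fin k)
edgeColours φ []           = []
edgeColours φ (x ∷ [])     = []
edgeColours φ (x ∷ y ∷ vs) = col φ x y ∷ edgeColours φ (y ∷ vs)

data LooseColours {k : ℕ} : List (Fin k) → Set where
  one   : ∀ a → LooseColours (a ∷ [])
  two   : ∀ a b → a ≢ b → LooseColours (a ∷ b ∷ [])
  three : ∀ cs → 3 ≤ length cs →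
          (∃[ a ] ∃[ b ] ∃[ c ] (a ∈ cs × b ∈ cs × c ∈ cs × a ≢ b × a ≢ c × b ≢ c)) →
          LooseColours cs

IsLoose : {G : Graph} {k : ℕ} → EdgeColouring G k → {u v : V G} → Path G u v → Set
IsLoose φ {u} {v} p = LooseColours (edgeColours φ (u ∷ interior p ∷ʳ v))

LooseEdgeConnected : (G : Graph) {k : ℕ} → EdgeColouring G k → Set
LooseEdgeConnected G φ = ∀ (u v : V G) → u ≢ v → Σ (Path G u v) (IsLoose φ)

LecColourable : Graph → ℕ → Set
LecColourable G k = Σ (EdgeColouring G k) (LooseEdgeConnected G)

LecIs : Graph → ℕ → Set
LecIs G k = LecColourable G k × (∀ j → j < k → ¬ LecColourable G j)

KAdj : (r s : ℕ) → Fin r ⊎ Fin s → Fin r ⊎ Fin s → Set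
KAdj r s (inj₁ _) (inj₂ _) = ⊤
KAdj r s (inj₂ _) (inj₁ _) = ⊤
KAdj r s (inj₁ _) (inj₁ _) = ⊥
KAdj r s (inj₂ _) (inj₂ _) = ⊥

KAdj-sym : (r s : ℕ) → ∀ {u v} → KAdj r s u v → KAdj r s v u
KAdj-sym r s {inj₁ _} {inj₂ _} t = t
KAdj-sym r s {inj₂ _} {inj₁ _} t = t

KAdj-irrefl : (r s : ℕ) → ∀ {u} → ¬ KAdj r s u u
KAdj-irrefl r s {inj₁ _} ()
KAdj-irrefl r s {inj₂ _} ()

K : ℕ → ℕ → Graph
K r s = record { V = Fin r ⊎ Fin s ; Adj = KAdj r s ; sym = KAdj-sym r s ; irrefl = KAdj-irrefl r s }

-- Colour K_{r,s} by a matrix h of colours, h i j being the colour of the edge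
-- between the i-th and the j-th vertex of the two sides. Two vertices of the same
-- side are joined by a loose path of length two exactly when their rows (columns)
-- of h differ somewhere. With two colours every loose path has at most two edges,
-- so lec(K_{r,s}) = 2 iff some 0/1 matrix has pairwise distinct rows and pairwise
-- distinct columns: for s ≤ r ≤ 2^s start from the identity matrix and keep adding
-- a row not yet present, while for r > 2^s two rows coincide. Three colours always
-- suffice, via explicit paths of length four. In the star two leaves are joined
-- only through the centre, so all s edges need distinct colours.
module Submission where

open import Defs hiding (sym)
open import Data.Nat using (ℕ; zero; suc; _≤_; _<_; _^_; _≤′_; ≤′-refl; ≤′-step; z≤n; s≤s)
open import Data.Nat.Properties using (≤-refl; ≤-trans; <⇒≤; m<1+n⇒m<n∨m≡n; m^n>0; ≤⇒≤′)
open import Data.Fin using (Fin; zero; suc; _≟_; funToFin; finToFun; combine)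
open import Data.Fin.Patterns using (0F; 1F; 2F)
open import Data.Fin.Properties using (¬Fin0; pigeonhole; <⇒≢; <⇒notInjective; any?; ¬∀⟶∃¬; funToFin-finToFin; finToFun-funToFin)
import Data.Vec.Functional as Vector
open import Data.Bool using (if_then_else_)
open import Data.Sum using (_⊎_; inj₁; inj₂)
open import Data.Sum.Properties using (inj₁-injective; inj₂-injective)
open import Data.Product using (Σ; _×_; _,_; ∃-syntax; proj₁; proj₂; map₂)
open import Data.Unit using (tt)
open import Data.Empty using (⊥; ⊥-elim)
open import Data.List using (List; []; _∷_; _∷ʳ_; length)
open import Data.List.Relation.Unary.Linked using ([-]; _∷_)
open import Data.List.Relation.Unary.AllPairs using ([]; _∷_)
open import Data.List.Relation.Unary.All using ([]; _∷_)
open import Data.List.Relation.Unary.Any using (here; there)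
open import Function using (_∘_; flip)
open import Function.Definitions using (Injective)
open import Relation.Binary.PropositionalEquality using (_≡_; _≢_; _≗_; refl; sym; trans; cong; cong₂; subst; subst₂; ≢-sym; module ≡-Reasoning)
open import Relation.Nullary using (¬_; does; contradiction)
open import Relation.Nullary.Decidable using (dec-true; dec-false)

funToFin-cong : ∀ {m n} {f g : Fin m → Fin n} → f ≗ g → funToFin f ≡ funToFin g
funToFin-cong {zero}  f≗g = refl
funToFin-cong {suc m} f≗g = cong₂ combine (f≗g zero) (funToFin-cong (f≗g ∘ suc))

funToFin-injective : ∀ {m n} {f g : Fin m → Fin n} → funToFin f ≡ funToFin g → f ≗ g
funToFin-injective {f = f} {g} eq j =
  trans (sym (finToFun-funToFin f j)) (trans (cong (λ c → finToFun c j) eq) (finToFun-funToFin g j))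

differentAt : ∀ {n k} {f g : Fin n → Fin k} → ¬ f ≗ g → ∃[ j ] f j ≢ g j
differentAt {n} {f = f} {g} = ¬∀⟶∃¬ n _ (λ j → f j ≟ g j)

missingValue : ∀ {m n} → m < n → (f : Fin m → Fin n) → ∃[ y ] (∀ x → f x ≢ y)
missingValue {m} {n} m<n f =
  map₂ (λ notHit x fx≡y → notHit (x , fx≡y)) (¬∀⟶∃¬ n _ (λ y → any? (λ x → f x ≟ y)) notSurjective)
  where
  notSurjective : ¬ (∀ y → ∃[ x ] f x ≡ y)
  notSurjective hit = <⇒notInjective m<n section-injective
    where
    section-injective : Injective _≡_ _≡_ (proj₁ ∘ hit)
    section-injective {y} {y′} eq = trans (sym (proj₂ (hit y))) (trans (cong f eq) (proj₂ (hit y′)))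

missingRow : ∀ {r s k} → r < k ^ s → (h : Fin r → Fin s → Fin k) →
             ∃[ v ] (∀ i → ∃[ j ] v j ≢ h i j)
missingRow {s = s} {k} r<kˢ h with missingValue r<kˢ (funToFin ∘ h)
... | y , unused = finToFun y , λ i → differentAt λ v≗hi → unused i (begin
  funToFin (h i)                ≡⟨ funToFin-cong (sym ∘ v≗hi) ⟩
  funToFin (finToFun {k} {s} y) ≡⟨ funToFin-finToFin {s} {k} y ⟩
  y                             ∎)
  where open ≡-Reasoning

RowsSeparated : ∀ {r s k} → (Fin r → Fin s → Fin k) → Set
RowsSeparated {r} h = ∀ (i i′ : Fin r) → i ≢ i′ → ∃[ j ] h i j ≢ h i′ j

ColumnsSeparated : ∀ {r s k} → (Fin r → Fin s → Fin k) → Set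
ColumnsSeparated h = RowsSeparated (flip h)

identityMatrix : ∀ {n} → Fin n → Fin n → Fin 2
identityMatrix i j = if does (i ≟ j) then 1F else 0F

identityMatrix-diagonal : ∀ {n} (i : Fin n) → identityMatrix i i ≡ 1F
identityMatrix-diagonal i rewrite dec-true (i ≟ i) refl = refl

identityMatrix-offDiagonal : ∀ {n} {i j : Fin n} → i ≢ j → identityMatrix i j ≡ 0F
identityMatrix-offDiagonal {i = i} {j} i≢j rewrite dec-false (i ≟ j) i≢j = refl

identityMatrix-rowsSeparated : ∀ {n} → RowsSeparated (identityMatrix {n})
identityMatrix-rowsSeparated i i′ i≢i′ =
  i , subst₂ _≢_ (sym (identityMatrix-diagonal i)) (sym (identityMatrix-offDiagonal (≢-sym i≢i′))) (λ ())

identityMatrix-columnsSeparated : ∀ {n} → ColumnsSeparated (identityMatrix {n})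
identityMatrix-columnsSeparated j j′ j≢j′ =
  j , subst₂ _≢_ (sym (identityMatrix-diagonal j)) (sym (identityMatrix-offDiagonal j≢j′)) (λ ())

module _ {r s k} {h : Fin r → Fin s → Fin k} {v : Fin s → Fin k} where

  ∷-rowsSeparated : RowsSeparated h → (∀ i → ∃[ j ] v j ≢ h i j) → RowsSeparated (v Vector.∷ h)
  ∷-rowsSeparated sep new zero    zero     0≢0 = contradiction refl 0≢0
  ∷-rowsSeparated sep new zero    (suc i′) _   = new i′
  ∷-rowsSeparated sep new (suc i) zero     _   = map₂ ≢-sym (new i)
  ∷-rowsSeparated sep new (suc i) (suc i′) ne  = sep i i′ (ne ∘ cong suc)

  ∷-columnsSeparated : ColumnsSeparated h → ColumnsSeparated (v Vector.∷ h)
  ∷-columnsSeparated sep j j′ j≢j′ with sep j j′ j≢j′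
  ... | i , differ = suc i , differ

separatedMatrix : ∀ {s r} → s ≤′ r → r ≤ 2 ^ s →
                  ∃[ h ] (RowsSeparated {r} {s} h × ColumnsSeparated h)
separatedMatrix ≤′-refl _ =
  identityMatrix , identityMatrix-rowsSeparated , identityMatrix-columnsSeparated
separatedMatrix (≤′-step s≤′r) r<2ˢ with separatedMatrix s≤′r (<⇒≤ r<2ˢ)
... | h , rows , columns with missingRow r<2ˢ h
... | v , new = v Vector.∷ h , ∷-rowsSeparated rows new , ∷-columnsSeparated columns

module _ {G : Graph} {k} (φ : EdgeColouring G k) where

  edgePath : ∀ {u v} → Adj G u v → u ≢ v → Σ (Path G u v) (IsLoose φ)
  edgePath uv u≢v =
    record { interior = [] ; linked = uv ∷ [-] ; distinct = (u≢v ∷ []) ∷ [] ∷ [] } , one _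

  twoEdgePath : ∀ {u w v} → Adj G u w → Adj G w v → u ≢ w → u ≢ v → w ≢ v →
                col φ u w ≢ col φ w v → Σ (Path G u v) (IsLoose φ)
  twoEdgePath uw wv u≢w u≢v w≢v colours≢ =
    record { interior = _ ∷ [] ; linked = uw ∷ wv ∷ [-]
           ; distinct = (u≢w ∷ u≢v ∷ []) ∷ (w≢v ∷ []) ∷ [] ∷ [] }
    , two _ _ colours≢

  length-edgeColours : ∀ u xs v → length (edgeColours φ (u ∷ xs ∷ʳ v)) ≡ suc (length xs)
  length-edgeColours u []       v = refl
  length-edgeColours u (x ∷ xs) v = cong suc (length-edgeColours x xs v)

  commonColour⇒¬loose : ∀ {u w v} → Adj G v w → col φ u w ≡ col φ v w →
                        ¬ LooseColours (edgeColours φ (u ∷ w ∷ v ∷ []))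
  commonColour⇒¬loose vw same (two _ _ colours≢) = colours≢ (trans same (colSym φ vw))
  commonColour⇒¬loose vw same (three _ (s≤s (s≤s ())) _)

looseColours-length₁ : {cs : List (Fin 1)} → LooseColours cs → length cs ≤ 1
looseColours-length₁ (one _)                                        = ≤-refl
looseColours-length₁ (two 0F 0F a≢b)                                = contradiction refl a≢b
looseColours-length₁ (three _ _ (0F , 0F , _ , _ , _ , _ , a≢b , _)) = contradiction refl a≢b

Fin2-noThreeDistinct : (a b c : Fin 2) → a ≢ b → a ≢ c → b ≢ c → ⊥
Fin2-noThreeDistinct 0F 0F _  a≢b _   _   = a≢b refl
Fin2-noThreeDistinct 1F 1F _  a≢b _   _   = a≢b refl
Fin2-noThreeDistinct 0F 1F 0F _   a≢c _   = a≢c refl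
Fin2-noThreeDistinct 1F 0F 1F _   a≢c _   = a≢c refl
Fin2-noThreeDistinct 0F 1F 1F _   _   b≢c = b≢c refl
Fin2-noThreeDistinct 1F 0F 0F _   _   b≢c = b≢c refl

looseColours-length₂ : {cs : List (Fin 2)} → LooseColours cs → length cs ≤ 2
looseColours-length₂ (one _)     = s≤s z≤n
looseColours-length₂ (two _ _ _) = ≤-refl
looseColours-length₂ (three _ _ (a , b , c , _ , _ , _ , a≢b , a≢c , b≢c)) =
  ⊥-elim (Fin2-noThreeDistinct a b c a≢b a≢c b≢c)

module _ {G : Graph} where

  ¬lecColourable₀ : V G → ¬ LecColourable G 0
  ¬lecColourable₀ v (φ , _) = ¬Fin0 (col φ v v)

  nonadjacent⇒¬lecColourable₁ : ∀ {u v} → u ≢ v → ¬ Adj G u v → ¬ LecColourable G 1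
  nonadjacent⇒¬lecColourable₁ {u} {v} u≢v ¬uv (φ , connected) with connected u v u≢v
  ... | record { interior = [] ; linked = uv ∷ _ } , _ = ¬uv uv
  ... | record { interior = w ∷ ws } , loose
    with subst (_≤ 1) (length-edgeColours φ u (w ∷ ws) v) (looseColours-length₁ loose)
  ... | s≤s ()

  colourTwins⇒¬loose : (φ : EdgeColouring G 2) → ∀ {u v} → ¬ Adj G u v →
                       (∀ w → Adj G w v → col φ u w ≡ col φ v w) →
                       (p : Path G u v) → ¬ IsLoose φ p
  colourTwins⇒¬loose φ ¬uv twins record { interior = [] ; linked = uv ∷ _ } _ = ¬uv uv
  colourTwins⇒¬loose φ ¬uv twins record { interior = w ∷ [] ; linked = _ ∷ wv ∷ _ } loose =
    commonColour⇒¬loose φ (Graph.sym G wv) (twins w wv) loose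
  colourTwins⇒¬loose φ {u} {v} ¬uv twins record { interior = w ∷ w′ ∷ ws } loose
    with subst (_≤ 2) (length-edgeColours φ u (w ∷ w′ ∷ ws) v) (looseColours-length₂ loose)
  ... | s≤s (s≤s ())

  lowerBound-suc : ∀ {k} → (∀ j → j < k → ¬ LecColourable G j) → ¬ LecColourable G k →
                   ∀ j → j < suc k → ¬ LecColourable G j
  lowerBound-suc below ¬k j j<1+k with m<1+n⇒m<n∨m≡n j<1+k
  ... | inj₁ j<k  = below j j<k
  ... | inj₂ refl = ¬k

  nonadjacent⇒lowerBound₂ : ∀ {u v} → u ≢ v → ¬ Adj G u v → ∀ j → j < 2 → ¬ LecColourable G j
  nonadjacent⇒lowerBound₂ {u} u≢v ¬uv =
    lowerBound-suc (lowerBound-suc (λ _ ()) (¬lecColourable₀ u)) (nonadjacent⇒¬lecColourable₁ u≢v ¬uv)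

module _ {r s k} (c₀ : Fin k) (h : Fin r → Fin s → Fin k) where

  bipartiteColour : Fin r ⊎ Fin s → Fin r ⊎ Fin s → Fin k
  bipartiteColour (inj₁ i) (inj₂ j) = h i j
  bipartiteColour (inj₂ j) (inj₁ i) = h i j
  bipartiteColour (inj₁ _) (inj₁ _) = c₀
  bipartiteColour (inj₂ _) (inj₂ _) = c₀

  bipartiteColouring : EdgeColouring (K r s) k
  bipartiteColouring = record
    { col    = bipartiteColour
    ; colSym = λ { {inj₁ _} {inj₂ _} _ → refl ; {inj₂ _} {inj₁ _} _ → refl } }

  rowPath : ∀ {i i′} j → i ≢ i′ → h i j ≢ h i′ j →
            Σ (Path (K r s) (inj₁ i) (inj₁ i′)) (IsLoose bipartiteColouring)
  rowPath j i≢i′ = twoEdgePath bipartiteColouring {w = inj₂ j} tt tt (λ ()) (i≢i′ ∘ inj₁-injective) (λ ())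

  columnPath : ∀ {j j′} i → j ≢ j′ → h i j ≢ h i j′ →
               Σ (Path (K r s) (inj₂ j) (inj₂ j′)) (IsLoose bipartiteColouring)
  columnPath i j≢j′ = twoEdgePath bipartiteColouring {w = inj₁ i} tt tt (λ ()) (j≢j′ ∘ inj₂-injective) (λ ())

  separated⇒looseEdgeConnected : RowsSeparated h → ColumnsSeparated h →
                                 LooseEdgeConnected (K r s) bipartiteColouring
  separated⇒looseEdgeConnected rows columns (inj₁ i) (inj₁ i′) ne with rows i i′ (ne ∘ cong inj₁)
  ... | j , differ = rowPath j (ne ∘ cong inj₁) differ
  separated⇒looseEdgeConnected rows columns (inj₂ j) (inj₂ j′) ne with columns j j′ (ne ∘ cong inj₂)
  ... | i , differ = columnPath i (ne ∘ cong inj₂) differ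
  separated⇒looseEdgeConnected rows columns (inj₁ i) (inj₂ j) ne = edgePath bipartiteColouring tt ne
  separated⇒looseEdgeConnected rows columns (inj₂ j) (inj₁ i) ne = edgePath bipartiteColouring tt ne

lec-star : ∀ s → 1 ≤ s → LecIs (K 1 s) s
lec-star s@(suc _) _ =
  (bipartiteColouring 0F centreColour , separated⇒looseEdgeConnected 0F centreColour rows columns)
  , lowerBound
  where
  centreColour : Fin 1 → Fin s → Fin s
  centreColour _ j = j

  rows : RowsSeparated centreColour
  rows 0F 0F 0≢0 = contradiction refl 0≢0

  columns : ColumnsSeparated centreColour
  columns j j′ j≢j′ = 0F , j≢j′

  sameCentreColour⇒¬loose : ∀ {k} (φ : EdgeColouring (K 1 s) k) {x y} →
                            col φ (inj₂ x) (inj₁ 0F) ≡ col φ (inj₂ y) (inj₁ 0F) →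
                            (p : Path (K 1 s) (inj₂ x) (inj₂ y)) → ¬ IsLoose φ p
  sameCentreColour⇒¬loose φ same record { interior = [] ; linked = () ∷ _ }
  sameCentreColour⇒¬loose φ same record { interior = inj₂ _ ∷ _ ; linked = () ∷ _ }
  sameCentreColour⇒¬loose φ same record { interior = inj₁ 0F ∷ [] } = commonColour⇒¬loose φ tt same
  sameCentreColour⇒¬loose φ same record { interior = inj₁ 0F ∷ inj₁ _ ∷ _ ; linked = _ ∷ () ∷ _ }
  sameCentreColour⇒¬loose φ same record { interior = inj₁ 0F ∷ inj₂ _ ∷ [] ; linked = _ ∷ _ ∷ () ∷ _ }
  sameCentreColour⇒¬loose φ same record { interior = inj₁ 0F ∷ inj₂ _ ∷ inj₂ _ ∷ _
                                        ; linked = _ ∷ _ ∷ () ∷ _ }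
  sameCentreColour⇒¬loose φ same record { interior = inj₁ 0F ∷ inj₂ _ ∷ inj₁ 0F ∷ _
                                        ; distinct = _ ∷ (_ ∷ centre≢centre ∷ _) ∷ _ } =
    contradiction refl centre≢centre

  lowerBound : ∀ j → j < s → ¬ LecColourable (K 1 s) j
  lowerBound j j<s (φ , connected) with pigeonhole j<s (λ x → col φ (inj₂ x) (inj₁ 0F))
  ... | x , y , x<y , same with connected (inj₂ x) (inj₂ y) (<⇒≢ x<y ∘ inj₂-injective)
  ... | p , loose = sameCentreColour⇒¬loose φ same p loose

K-lowerBound₂ : ∀ {r s} → 2 ≤ s → ∀ j → j < 2 → ¬ LecColourable (K r s) j
K-lowerBound₂ (s≤s (s≤s _)) = nonadjacent⇒lowerBound₂ {u = inj₂ 0F} {v = inj₂ 1F} (λ ()) (λ ())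

lec-two : ∀ r s → 2 ≤ s → s ≤ r → r ≤ 2 ^ s → LecIs (K r s) 2
lec-two r s 2≤s s≤r r≤2ˢ with separatedMatrix (≤⇒≤′ s≤r) r≤2ˢ
... | h , rows , columns =
  (bipartiteColouring 0F h , separated⇒looseEdgeConnected 0F h rows columns) , K-lowerBound₂ 2≤s

manyRows⇒¬lecColourable₂ : ∀ {r s} → 2 ^ s < r → ¬ LecColourable (K r s) 2
manyRows⇒¬lecColourable₂ 2ˢ<r (φ , connected)
  with pigeonhole 2ˢ<r (λ i → funToFin (λ j → col φ (inj₁ i) (inj₂ j)))
... | i , i′ , i<i′ , sameCode with connected (inj₁ i) (inj₁ i′) (<⇒≢ i<i′ ∘ inj₁-injective)
... | p , loose = colourTwins⇒¬loose φ (λ ()) twins p loose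
  where
  twins : ∀ w → KAdj _ _ w (inj₁ i′) → col φ (inj₁ i) w ≡ col φ (inj₁ i′) w
  twins (inj₂ j) _ = funToFin-injective sameCode j

threeColourMatrix : ∀ {r s} → Fin r → Fin s → Fin 3
threeColourMatrix 0F      _       = 2F
threeColourMatrix (suc _) 0F      = 1F
threeColourMatrix (suc _) (suc _) = 0F

-- Rows (columns) other than the first coincide; such pairs are joined through the
-- first row and first column, whose edges see all three colours.
threeColourMatrix-looseEdgeConnected : ∀ r s →
  LooseEdgeConnected (K (suc (suc r)) (suc (suc s))) (bipartiteColouring 0F threeColourMatrix)
threeColourMatrix-looseEdgeConnected r s = connected
  where
  φ : EdgeColouring (K (suc (suc r)) (suc (suc s))) 3
  φ = bipartiteColouring 0F threeColourMatrix

  connected : LooseEdgeConnected _ φ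
  connected (inj₁ 0F)      (inj₁ 0F)      ne = contradiction refl ne
  connected (inj₁ 0F)      (inj₁ (suc _)) ne = rowPath 0F threeColourMatrix 1F (ne ∘ cong inj₁) (λ ())
  connected (inj₁ (suc _)) (inj₁ 0F)      ne = rowPath 0F threeColourMatrix 1F (ne ∘ cong inj₁) (λ ())
  connected (inj₁ (suc x)) (inj₁ (suc y)) ne =
    record { interior = inj₂ 1F ∷ inj₁ 0F ∷ inj₂ 0F ∷ []
           ; linked   = tt ∷ tt ∷ tt ∷ tt ∷ [-]
           ; distinct = ((λ ()) ∷ (λ ()) ∷ (λ ()) ∷ ne ∷ []) ∷ ((λ ()) ∷ (λ ()) ∷ (λ ()) ∷ [])
                      ∷ ((λ ()) ∷ (λ ()) ∷ []) ∷ ((λ ()) ∷ []) ∷ [] ∷ [] }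
    , three _ (s≤s (s≤s (s≤s z≤n)))
        (0F , 2F , 1F , here refl , there (here refl) , there (there (there (here refl)))
        , (λ ()) , (λ ()) , (λ ()))
  connected (inj₂ 0F)      (inj₂ 0F)      ne = contradiction refl ne
  connected (inj₂ 0F)      (inj₂ (suc _)) ne = columnPath 0F threeColourMatrix 1F (ne ∘ cong inj₂) (λ ())
  connected (inj₂ (suc _)) (inj₂ 0F)      ne = columnPath 0F threeColourMatrix 1F (ne ∘ cong inj₂) (λ ())
  connected (inj₂ (suc x)) (inj₂ (suc y)) ne =
    record { interior = inj₁ 0F ∷ inj₂ 0F ∷ inj₁ 1F ∷ []
           ; linked   = tt ∷ tt ∷ tt ∷ tt ∷ [-]
           ; distinct = ((λ ()) ∷ (λ ()) ∷ (λ ()) ∷ ne ∷ []) ∷ ((λ ()) ∷ (λ ()) ∷ (λ ()) ∷ [])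
                      ∷ ((λ ()) ∷ (λ ()) ∷ []) ∷ ((λ ()) ∷ []) ∷ [] ∷ [] }
    , three _ (s≤s (s≤s (s≤s z≤n)))
        (2F , 1F , 0F , here refl , there (there (here refl)) , there (there (there (here refl)))
        , (λ ()) , (λ ()) , (λ ()))
  connected (inj₁ _) (inj₂ _) ne = edgePath φ tt ne
  connected (inj₂ _) (inj₁ _) ne = edgePath φ tt ne

lecColourable₃ : ∀ {r s} → 2 ≤ r → 2 ≤ s → LecColourable (K r s) 3
lecColourable₃ {suc (suc r)} {suc (suc s)} (s≤s (s≤s _)) (s≤s (s≤s _)) =
  bipartiteColouring 0F threeColourMatrix , threeColourMatrix-looseEdgeConnected r s

lec-three : ∀ r s → 2 ≤ s → 2 ^ s < r → LecIs (K r s) 3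
lec-three r s 2≤s 2ˢ<r =
  lecColourable₃ (≤-trans (s≤s (m^n>0 2 s)) 2ˢ<r) 2≤s
  , lowerBound-suc (K-lowerBound₂ 2≤s) (manyRows⇒¬lecColourable₂ 2ˢ<r)

theorem3 : (∀ (s : ℕ) → 1 ≤ s → LecIs (K 1 s) s)
         × (∀ (r s : ℕ) → 2 ≤ s → s ≤ r → r ≤ 2 ^ s → LecIs (K r s) 2)
         × (∀ (r s : ℕ) → 2 ≤ s → 2 ^ s < r → LecIs (K r s) 3)
theorem3 = lec-star , lec-two , lec-three
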